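{- For all positive integers $r,n$, \[ \frac{\sum_{\gamma\in G(r,n)}t^{\mathrm{des}_G(\gamma)}q^{\mathrm{maj}(\gamma)}a^{\mathrm{col}(\gamma)}}{(t;q)_{n+1}}=\sum_{k\ge0}\big([k+1]_q+a[r-1]_a[k]_q\big)^n t^k. \]
   Context: $(t;q)_m=(1-t)(1-tq)\cdots(1-tq^{m-1})$; $[m]_q=1+q+\dots+q^{m-1}$ ($[0]_q=0$); $[r-1]_a=1+a+\dots+a^{r-2}$. $G(r,n)$ is the set of $r$-colored permutations $\gamma=(c_1,\dots,c_n;\sigma)$, $c_i\in\{0,\dots,r-1\}$, $\sigma\in S_n$, written $\gamma=[\gamma(1),\dots,\gamma(n)]=[\sigma(1)^{c_1},\dots,\sigma(n)^{c_n}]$. Colored integers $x^c$ ($x^0=x$) are totally ordered by: uncolored integers in natural order; every $x^c$ with $c\ge1$ is smaller than every uncolored integer (including $0$); for $c,d\ge1$, $x^c<y^d$ iff $x>y$, or $x=y$ and $c>d$. $\mathrm{Des}_G(\gamma)=\{i\in\{0,\dots,n-1\}:\gamma(i)>\gamma(i+1)\}$ with $\gamma(0):=0$; $\mathrm{des}_G=|\mathrm{Des}_G|$; $\mathrm{maj}(\gamma)=\sum_{i\in\mathrm{Des}_G(\gamma)}i$; $\mathrm{col}(\gamma)=\sum_ic_i$. -}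

module Defs where

open import Level using (Level)
open import Algebra.Bundles using (CommutativeRing)
open import Data.Nat using (ℕ; zero; suc; _∸_; _<ᵇ_; _≡ᵇ_)
import Data.Nat as ℕ
open import Data.Bool using (Bool; true; false; if_then_else_; _∨_; _∧_)
open import Data.Product using (_×_; _,_; proj₂)
open import Data.List using (List; []; _∷_; map; concatMap; zip; upTo; length; foldr)
open import Data.Nat.ListAction using () renaming (sum to sumℕ)

-- A colored integer x^c is the pair (x , c).
ColInt : Set
ColInt = ℕ × ℕ

CPerm : Set
CPerm = List ColInt

insertions : ℕ → List ℕ → List (List ℕ)
insertions x [] = (x ∷ []) ∷ []
insertions x (y ∷ ys) = (x ∷ y ∷ ys) ∷ map (y ∷_) (insertions x ys)

perms : ℕ → List (List ℕ)
perms zero = [] ∷ []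
perms (suc n) = concatMap (insertions (suc n)) (perms n)

colorings : ℕ → ℕ → List (List ℕ)
colorings r zero = [] ∷ []
colorings r (suc n) = concatMap (λ cs → map (_∷ cs) (upTo r)) (colorings r n)

G : ℕ → ℕ → List CPerm
G r n = concatMap (λ σ → map (zip σ) (colorings r n)) (perms n)

_<c_ : ColInt → ColInt → Bool
(x , zero)  <c (y , zero)  = x <ᵇ y
(x , suc c) <c (y , zero)  = true
(x , zero)  <c (y , suc d) = false
(x , suc c) <c (y , suc d) = (y <ᵇ x) ∨ ((x ≡ᵇ y) ∧ (d <ᵇ c))

-- desList i p w : descent positions, where p = γ(i) and w = γ(i+1), γ(i+2), …
desList : ℕ → ColInt → List ColInt → List ℕ
desList i p [] = []
desList i p (x ∷ xs) =
  if x <c p then i ∷ desList (suc i) x xs else desList (suc i) x xs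

-- Des_G(γ), with γ(0) := 0
DesG : CPerm → List ℕ
DesG γ = desList 0 (0 , 0) γ

desG : CPerm → ℕ
desG γ = length (DesG γ)

maj : CPerm → ℕ
maj γ = sumℕ (DesG γ)

col : CPerm → ℕ
col γ = sumℕ (map proj₂ γ)

-- Algebra over an arbitrary commutative ring R (q, a ∈ R);
-- formal power series in t are coefficient sequences ℕ → R.

module _ {c ℓ : Level} (R : CommutativeRing c ℓ) where
  open CommutativeRing R using (Carrier; _+_; _*_; _-_; 0#; 1#)

  pow : Carrier → ℕ → Carrier
  pow x zero = 1#
  pow x (suc m) = x * pow x m

  qint : Carrier → ℕ → Carrier
  qint x zero = 0#
  qint x (suc m) = 1# + x * qint x m

  sumR : List Carrier → Carrier
  sumR = foldr _+_ 0#

  -- coefficient of t^k in (t;q)_m = (1-t)(1-tq)⋯(1-tq^{m-1})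
  poch : Carrier → ℕ → ℕ → Carrier
  poch q zero zero = 1#
  poch q zero (suc k) = 0#
  poch q (suc m) zero = poch q m zero
  poch q (suc m) (suc k) = poch q m (suc k) - pow q m * poch q m k

  conv : (ℕ → Carrier) → (ℕ → Carrier) → ℕ → Carrier
  conv f g k = sumR (map (λ j → f j * g (k ∸ j)) (upTo (suc k)))

  numer : ℕ → ℕ → Carrier → Carrier → ℕ → Carrier
  numer r n q a k =
    sumR (map (λ γ → if desG γ ≡ᵇ k then pow q (maj γ) * pow a (col γ) else 0#) (G r n))

  rhs : ℕ → ℕ → Carrier → Carrier → ℕ → Carrier
  rhs r n q a k = pow (qint q (suc k) + a * qint a (r ∸ 1) * qint q k) n

module Submission where

-- Both sides, read as coefficient sequences in t, satisfy the same recursion in n,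
--   f_(n+1)(k) = f_n(k) X_k + f_n(k-1) Y_(n,k-1),
-- where X_k = [k+1]_q + α[k]_q, α = a[r-1]_a and Y_(n,d) = (1+α)[n+1]_q - X_d,
-- and they agree at n = 0.
-- Left side: every element of G(r,n+1) arises exactly once by inserting the letter
-- (n+1)^c into some γ ∈ G(r,n). In the colored order (n+1)^0 lies above and (n+1)^c,
-- c ≥ 1, below all letters of γ. If γ has d descents and major index m, summing
-- t^des q^maj over the n+1 positions gives t^d q^m [d+1] + t^(d+1) q^(m+d+1) [n-d]
-- for the top letter and t^d q^m [d] + t^(d+1) q^(m+d) [n+1-d] for a bottom one;
-- weighting the colors by a^c turns this into t^d q^m (X_d + t Y_(n,d)).
-- Right side: (t;q)_(n+2) = (t;q)_(n+1) (1 - q^(n+1) t), and the coefficients c_i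
-- of (t;q)_m satisfy [i+1] c_(i+1) = - q^i [m-i] c_i.

open import Defs
open import Level using (Level)
open import Algebra.Bundles using (CommutativeRing)
open import Data.Bool using (Bool; true; false; if_then_else_; T)
open import Data.Unit using (tt)
open import Data.Nat using (ℕ; zero; suc; _∸_; _≤_; _<_; z≤n; s≤s; _<ᵇ_; _≡ᵇ_)
import Data.Nat as ℕ
import Data.Nat.Properties as ℕₚ
open import Data.Nat.ListAction using (sum)
open import Data.Nat.Tactic.RingSolver using (solve-∀)
open import Algebra.Properties.CommutativeSemigroup ℕₚ.+-commutativeSemigroup using () renaming (x∙yz≈y∙xz to +-left-comm)
open import Data.Product using (_×_; _,_; proj₁; proj₂)
open import Data.List using (List; []; _∷_; map; concatMap; zip; upTo; length; _++_; _∷ʳ_)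
import Data.List.Properties as Listₚ
open import Data.List.Relation.Unary.All as All using (All; []; _∷_)
import Data.List.Relation.Unary.All.Properties as Allₚ
open import Relation.Nullary using (yes; no)
open import Relation.Binary.PropositionalEquality as ≡ using (_≡_)
open import Function using (_∘_)

<ᵇ-true : ∀ {m n} → m < n → (m <ᵇ n) ≡ true
<ᵇ-true {zero} {suc n} _ = ≡.refl
<ᵇ-true {suc m} {suc n} (s≤s m<n) = <ᵇ-true m<n

<ᵇ-false : ∀ {m n} → n ≤ m → (m <ᵇ n) ≡ false
<ᵇ-false z≤n = ≡.refl
<ᵇ-false (s≤s n≤m) = <ᵇ-false n≤m

≡ᵇ-false : ∀ {m n} → m < n → (m ≡ᵇ n) ≡ false
≡ᵇ-false {zero} {suc n} _ = ≡.refl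
≡ᵇ-false {suc m} {suc n} (s≤s m<n) = ≡ᵇ-false m<n

LettersBelow : ℕ → CPerm → Set
LettersBelow n = All (λ y → proj₁ y ≤ n)

<c-top : ∀ {n} {y : ColInt} → proj₁ y ≤ n → (y <c (suc n , 0)) ≡ true
<c-top {y = v , zero} v≤n = <ᵇ-true (s≤s v≤n)
<c-top {y = v , suc c} _ = ≡.refl

top-≮c : ∀ {n} {y : ColInt} → proj₁ y ≤ n → ((suc n , 0) <c y) ≡ false
top-≮c {y = v , zero} v≤n = <ᵇ-false (ℕₚ.m≤n⇒m≤1+n v≤n)
top-≮c {y = v , suc c} _ = ≡.refl

bottom-<c : ∀ {n d} {y : ColInt} → proj₁ y ≤ n → ((suc n , suc d) <c y) ≡ true
bottom-<c {y = v , zero} _ = ≡.refl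
bottom-<c {y = v , suc c} v≤n rewrite <ᵇ-true (s≤s v≤n) = ≡.refl

≮c-bottom : ∀ {n d} {y : ColInt} → proj₁ y ≤ n → (y <c (suc n , suc d)) ≡ false
≮c-bottom {y = v , zero} _ = ≡.refl
≮c-bottom {y = v , suc c} v≤n rewrite <ᵇ-false (ℕₚ.m≤n⇒m≤1+n v≤n) | ≡ᵇ-false (s≤s v≤n) = ≡.refl

-- Descent number and major index of w when preceded by the letter p, so that
-- desG γ = desAfter (0 , 0) γ and maj γ = majAfter (0 , 0) γ.
desAfter : ColInt → CPerm → ℕ
desAfter p w = length (desList 0 p w)

majAfter : ColInt → CPerm → ℕ
majAfter p w = sum (desList 0 p w)

desList-suc : ∀ i p w → desList (suc i) p w ≡ map suc (desList i p w)
desList-suc i p [] = ≡.refl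
desList-suc i p (x ∷ w) with x <c p
... | true = ≡.cong (suc i ∷_) (desList-suc (suc i) x w)
... | false = desList-suc (suc i) x w

sum-map-suc : ∀ xs → sum (map suc xs) ≡ length xs ℕ.+ sum xs
sum-map-suc [] = ≡.refl
sum-map-suc (x ∷ xs) = ≡.trans (≡.cong (λ s → suc (x ℕ.+ s)) (sum-map-suc xs)) (≡.cong suc (+-left-comm x (length xs) (sum xs)))

majAfter-∷ : ∀ p x w → majAfter p (x ∷ w) ≡ desAfter x w ℕ.+ majAfter x w
majAfter-∷ p x w = ≡.trans (drop-first-position p x w) (begin
  sum (desList 1 x w)                          ≡⟨ ≡.cong sum (desList-suc 0 x w) ⟩
  sum (map suc (desList 0 x w))                ≡⟨ sum-map-suc (desList 0 x w) ⟩
  length (desList 0 x w) ℕ.+ majAfter x w      ∎)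
  where
  open ≡.≡-Reasoning
  drop-first-position : ∀ p x w → majAfter p (x ∷ w) ≡ sum (desList 1 x w)
  drop-first-position p x w with x <c p
  ... | true = ≡.refl
  ... | false = ≡.refl

desAfter-descent : ∀ {p x} w → x <c p ≡ true → desAfter p (x ∷ w) ≡ suc (desAfter x w)
desAfter-descent {p} {x} w x<p rewrite x<p | desList-suc 0 x w = ≡.cong suc (Listₚ.length-map suc (desList 0 x w))

desAfter-ascent : ∀ {p x} w → x <c p ≡ false → desAfter p (x ∷ w) ≡ desAfter x w
desAfter-ascent {p} {x} w x≮p rewrite x≮p | desList-suc 0 x w = Listₚ.length-map suc (desList 0 x w)

length-desList≤ : ∀ i p w → length (desList i p w) ≤ length w
length-desList≤ i p [] = z≤n
length-desList≤ i p (x ∷ w) with x <c p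
... | true  = s≤s (length-desList≤ (suc i) x w)
... | false = ℕₚ.m≤n⇒m≤1+n (length-desList≤ (suc i) x w)

inserts : {A : Set} → A → List A → List (List A)
inserts x [] = (x ∷ []) ∷ []
inserts x (y ∷ ys) = (x ∷ y ∷ ys) ∷ map (y ∷_) (inserts x ys)

col-inserts : ∀ L γ → All (λ w → col w ≡ proj₂ L ℕ.+ col γ) (inserts L γ)
col-inserts L [] = ≡.refl ∷ []
col-inserts L (y ∷ ys) =
  ≡.refl ∷ Allₚ.map⁺ (All.map (λ eq → ≡.trans (≡.cong (proj₂ y ℕ.+_) eq) (+-left-comm (proj₂ y) (proj₂ L) (col ys)))
                              (col-inserts L ys))

concatMap⁺ : {A B : Set} {P : A → Set} {Q : B → Set} {g : A → List B} {xs : List A} →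
             (∀ {x} → P x → All Q (g x)) → All P xs → All Q (concatMap g xs)
concatMap⁺ g⁺ = Allₚ.concat⁺ ∘ Allₚ.map⁺ ∘ All.map g⁺

insertions-length : ∀ x σ → All (λ σ′ → length σ′ ≡ suc (length σ)) (insertions x σ)
insertions-length x [] = ≡.refl ∷ []
insertions-length x (y ∷ ys) = ≡.refl ∷ Allₚ.map⁺ (All.map (≡.cong suc) (insertions-length x ys))

insertions⁺ : ∀ {P : ℕ → Set} {x σ} → P x → All P σ → All (All P) (insertions x σ)
insertions⁺ px [] = (px ∷ []) ∷ []
insertions⁺ px (py ∷ pys) = (px ∷ py ∷ pys) ∷ Allₚ.map⁺ (All.map (py ∷_) (insertions⁺ px pys))

perms-length : ∀ n → All (λ σ → length σ ≡ n) (perms n)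
perms-length zero = ≡.refl ∷ []
perms-length (suc n) =
  concatMap⁺ (λ {σ} σ≡n → All.map (λ σ′≡ → ≡.trans σ′≡ (≡.cong suc σ≡n)) (insertions-length (suc n) σ)) (perms-length n)

perms-bounded : ∀ n → All (All (_≤ n)) (perms n)
perms-bounded zero = [] ∷ []
perms-bounded (suc n) =
  concatMap⁺ (λ σ≤n → insertions⁺ ℕₚ.≤-refl (All.map ℕₚ.m≤n⇒m≤1+n σ≤n)) (perms-bounded n)

colorings-length : ∀ r n → All (λ cs → length cs ≡ n) (colorings r n)
colorings-length r zero = ≡.refl ∷ []
colorings-length r (suc n) =
  concatMap⁺ (λ cs≡n → Allₚ.map⁺ (All.universal (λ _ → ≡.cong suc cs≡n) (upTo r))) (colorings-length r n)

length-zip : ∀ {A B : Set} (xs : List A) (ys : List B) → length xs ≡ length ys → length (zip xs ys) ≡ length xs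
length-zip [] ys _ = ≡.refl
length-zip (x ∷ xs) (y ∷ ys) eq = ≡.cong suc (length-zip xs ys (ℕₚ.suc-injective eq))

zip⁺ : ∀ {A B : Set} {P : A → Set} {xs : List A} (ys : List B) → All P xs → All (P ∘ proj₁) (zip xs ys)
zip⁺ ys [] = []
zip⁺ [] (px ∷ pxs) = []
zip⁺ (y ∷ ys) (px ∷ pxs) = px ∷ zip⁺ ys pxs

G-wellFormed : ∀ r n → All (λ γ → length γ ≡ n × LettersBelow n γ) (G r n)
G-wellFormed r n = concatMap⁺ zipped (All.zip (perms-length n , perms-bounded n))
  where
  zipped : ∀ {σ} → length σ ≡ n × All (_≤ n) σ → All (λ γ → length γ ≡ n × LettersBelow n γ) (map (zip σ) (colorings r n))
  zipped {σ} (σ≡n , σ≤n) = Allₚ.map⁺ (All.map (λ {cs} cs≡n →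
    ≡.trans (length-zip σ cs (≡.trans σ≡n (≡.sym cs≡n))) σ≡n , zip⁺ cs σ≤n) (colorings-length r n))

module _ {c ℓ : Level} (R : CommutativeRing c ℓ) where
  open CommutativeRing R hiding (zero)
  open import Relation.Binary.Reasoning.Setoid setoid
  open import Algebra.Solver.Ring.NaturalCoefficients.Default commutativeSemiring
  open import Algebra.Properties.Group +-group using (//-rightDividesˡ; ∙-cancelʳ)

  ∑ : {A : Set} → List A → (A → Carrier) → Carrier
  ∑ xs f = sumR R (map f xs)

  infix 5 ∑
  syntax ∑ xs (λ x → e) = ∑[ x ∈ xs ] e

  ∑-cong : {A : Set} (xs : List A) {f g : A → Carrier} → (∀ x → f x ≈ g x) → ∑ xs f ≈ ∑ xs g
  ∑-cong [] f≈g = refl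
  ∑-cong (x ∷ xs) f≈g = +-cong (f≈g x) (∑-cong xs f≈g)

  ∑-cong-All : {A : Set} {P : A → Set} {xs : List A} {f g : A → Carrier} →
               All P xs → (∀ {x} → P x → f x ≈ g x) → ∑ xs f ≈ ∑ xs g
  ∑-cong-All [] f≈g = refl
  ∑-cong-All (px ∷ pxs) f≈g = +-cong (f≈g px) (∑-cong-All pxs f≈g)

  ∑-++ : {A : Set} (xs ys : List A) (f : A → Carrier) → ∑ (xs ++ ys) f ≈ ∑ xs f + ∑ ys f
  ∑-++ [] ys f = sym (+-identityˡ _)
  ∑-++ (x ∷ xs) ys f = trans (+-cong refl (∑-++ xs ys f)) (sym (+-assoc _ _ _))

  ∑-concatMap : {A B : Set} (g : A → List B) (xs : List A) (f : B → Carrier) →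
                ∑ (concatMap g xs) f ≈ ∑[ x ∈ xs ] ∑ (g x) f
  ∑-concatMap g [] f = refl
  ∑-concatMap g (x ∷ xs) f = trans (∑-++ (g x) (concatMap g xs) f) (+-cong refl (∑-concatMap g xs f))

  ∑-map : {A B : Set} (h : A → B) (xs : List A) (f : B → Carrier) → ∑ (map h xs) f ≈ ∑[ x ∈ xs ] f (h x)
  ∑-map h xs f = reflexive (≡.cong (sumR R) (≡.sym (Listₚ.map-∘ xs)))

  ∑-zero : {A : Set} (xs : List A) → ∑[ x ∈ xs ] 0# ≈ 0#
  ∑-zero [] = refl
  ∑-zero (x ∷ xs) = trans (+-identityˡ _) (∑-zero xs)

  ∑-+ : {A : Set} (xs : List A) (f g : A → Carrier) → ∑[ x ∈ xs ] (f x + g x) ≈ ∑ xs f + ∑ xs g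
  ∑-+ [] f g = sym (+-identityˡ _)
  ∑-+ (x ∷ xs) f g = trans (+-cong refl (∑-+ xs f g))
    (solve 4 (λ a b c d → (a :+ b) :+ (c :+ d) := (a :+ c) :+ (b :+ d)) refl (f x) (g x) (∑ xs f) (∑ xs g))

  ∑-*ˡ : {A : Set} (xs : List A) (y : Carrier) (f : A → Carrier) → ∑[ x ∈ xs ] (y * f x) ≈ y * ∑ xs f
  ∑-*ˡ [] y f = sym (zeroʳ _)
  ∑-*ˡ (x ∷ xs) y f = trans (+-cong refl (∑-*ˡ xs y f)) (sym (distribˡ _ _ _))

  ∑-*ʳ : {A : Set} (xs : List A) (y : Carrier) (f : A → Carrier) → ∑[ x ∈ xs ] (f x * y) ≈ ∑ xs f * y
  ∑-*ʳ xs y f = trans (∑-cong xs (λ x → *-comm (f x) y)) (trans (∑-*ˡ xs y f) (*-comm _ _))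

  ∑-comm : {A B : Set} (xs : List A) (ys : List B) (f : A → B → Carrier) →
           ∑[ x ∈ xs ] ∑[ y ∈ ys ] f x y ≈ ∑[ y ∈ ys ] ∑[ x ∈ xs ] f x y
  ∑-comm [] ys f = sym (∑-zero ys)
  ∑-comm (x ∷ xs) ys f = trans (+-cong refl (∑-comm xs ys f)) (sym (∑-+ ys (f x) (λ y → ∑[ x′ ∈ xs ] f x′ y)))

  ∑-upTo-head : ∀ n (f : ℕ → Carrier) → ∑[ j ∈ upTo (suc n) ] f j ≈ f 0 + (∑[ j ∈ upTo n ] f (suc j))
  ∑-upTo-head n f = +-cong refl (reflexive (≡.cong (sumR R)
    (≡.trans (Listₚ.map-applyUpTo suc f n) (≡.sym (Listₚ.map-applyUpTo (λ j → j) (λ j → f (suc j)) n)))))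

  ∑-upTo-last : ∀ n (f : ℕ → Carrier) → ∑[ j ∈ upTo (suc n) ] f j ≈ (∑[ j ∈ upTo n ] f j) + f n
  ∑-upTo-last n f = begin
    ∑ (upTo (suc n)) f          ≡⟨ ≡.cong (λ js → ∑ js f) (≡.sym (Listₚ.upTo-∷ʳ n)) ⟩
    ∑ (upTo n ∷ʳ n) f           ≈⟨ ∑-++ (upTo n) (n ∷ []) f ⟩
    ∑ (upTo n) f + (f n + 0#)   ≈⟨ +-cong refl (+-identityʳ _) ⟩
    ∑ (upTo n) f + f n          ∎

  infixr 7 ⟦_⟧*_
  ⟦_⟧*_ : Bool → Carrier → Carrier
  ⟦ b ⟧* x = if b then x else 0#

  ⟦⟧*-cong : ∀ b {x y} → x ≈ y → ⟦ b ⟧* x ≈ ⟦ b ⟧* y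
  ⟦⟧*-cong true x≈y = x≈y
  ⟦⟧*-cong false _ = refl

  ⟦⟧*-*ʳ : ∀ b x y → (⟦ b ⟧* x) * y ≈ ⟦ b ⟧* (x * y)
  ⟦⟧*-*ʳ true x y = refl
  ⟦⟧*-*ʳ false x y = zeroˡ y

  ∑-⟦⟧* : {A : Set} (xs : List A) (b : Bool) (f : A → Carrier) → ∑[ x ∈ xs ] ⟦ b ⟧* f x ≈ ⟦ b ⟧* (∑ xs f)
  ∑-⟦⟧* xs true f = refl
  ∑-⟦⟧* xs false f = ∑-zero xs

  ⟦≡ᵇ⟧*-subst : ∀ d k (f : ℕ → Carrier) x → ⟦ d ≡ᵇ k ⟧* (x * f d) ≈ (⟦ d ≡ᵇ k ⟧* x) * f k
  ⟦≡ᵇ⟧*-subst d k f x with d ≡ᵇ k in d≡k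
  ... | true rewrite ℕₚ.≡ᵇ⇒≡ d k (≡.subst T (≡.sym d≡k) tt) = refl
  ... | false = sym (zeroˡ (f k))

  ⟦⟧*-pair : ∀ b₁ b₂ x₁ x₂ y₁ y₂ u v →
             (⟦ b₁ ⟧* x₁ + ⟦ b₂ ⟧* x₂) * u + (⟦ b₁ ⟧* y₁ + ⟦ b₂ ⟧* y₂) * v
               ≈ ⟦ b₁ ⟧* (x₁ * u + y₁ * v) + ⟦ b₂ ⟧* (x₂ * u + y₂ * v)
  ⟦⟧*-pair true  true  x₁ x₂ y₁ y₂ u v =
    solve 6 (λ x₁ x₂ y₁ y₂ u v → (x₁ :+ x₂) :* u :+ (y₁ :+ y₂) :* v := (x₁ :* u :+ y₁ :* v) :+ (x₂ :* u :+ y₂ :* v))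
      refl x₁ x₂ y₁ y₂ u v
  ⟦⟧*-pair true  false x₁ x₂ y₁ y₂ u v =
    solve 4 (λ x₁ y₁ u v → (x₁ :+ con 0) :* u :+ (y₁ :+ con 0) :* v := (x₁ :* u :+ y₁ :* v) :+ con 0) refl x₁ y₁ u v
  ⟦⟧*-pair false true  x₁ x₂ y₁ y₂ u v =
    solve 4 (λ x₂ y₂ u v → (con 0 :+ x₂) :* u :+ (con 0 :+ y₂) :* v := con 0 :+ (x₂ :* u :+ y₂ :* v)) refl x₂ y₂ u v
  ⟦⟧*-pair false false x₁ x₂ y₁ y₂ u v =
    solve 2 (λ u v → (con 0 :+ con 0) :* u :+ (con 0 :+ con 0) :* v := con 0 :+ con 0) refl u v

  pow-+ : ∀ x m n → pow R x (m ℕ.+ n) ≈ pow R x m * pow R x n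
  pow-+ x zero n = sym (*-identityˡ _)
  pow-+ x (suc m) n = trans (*-cong refl (pow-+ x m n)) (sym (*-assoc _ _ _))

  qint-+ : ∀ x m n → qint R x (m ℕ.+ n) ≈ qint R x m + pow R x m * qint R x n
  qint-+ x zero n = solve 1 (λ k → k := con 0 :+ con 1 :* k) refl (qint R x n)
  qint-+ x (suc m) n = begin
    1# + x * qint R x (m ℕ.+ n)                        ≈⟨ +-cong refl (*-cong refl (qint-+ x m n)) ⟩
    1# + x * (qint R x m + pow R x m * qint R x n)    ≈⟨ solve 4 (λ x a b c → con 1 :+ x :* (a :+ b :* c)
                                                            := (con 1 :+ x :* a) :+ (x :* b) :* c)
                                                          refl x (qint R x m) (pow R x m) (qint R x n) ⟩
    (1# + x * qint R x m) + (x * pow R x m) * qint R x n ∎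

  qint-sucʳ : ∀ x n → qint R x (suc n) ≈ qint R x n + pow R x n
  qint-sucʳ x n = begin
    qint R x (suc n)                        ≡⟨ ≡.cong (qint R x) (ℕₚ.+-comm 1 n) ⟩
    qint R x (n ℕ.+ 1)                      ≈⟨ qint-+ x n 1 ⟩
    qint R x n + pow R x n * (1# + x * 0#)   ≈⟨ +-cong refl (solve 2 (λ w x → w :* (con 1 :+ x :* con 0) := w) refl (pow R x n) x) ⟩
    qint R x n + pow R x n                  ∎

  ∑-pow-upTo : ∀ x e n → ∑[ j ∈ upTo n ] pow R x (e ℕ.+ j) ≈ pow R x e * qint R x n
  ∑-pow-upTo x e zero = sym (zeroʳ _)
  ∑-pow-upTo x e (suc n) = begin
    ∑[ j ∈ upTo (suc n) ] pow R x (e ℕ.+ j)                  ≈⟨ ∑-upTo-head n _ ⟩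
    pow R x (e ℕ.+ 0) + (∑[ j ∈ upTo n ] pow R x (e ℕ.+ suc j))
      ≡⟨ ≡.cong₂ _+_ (≡.cong (pow R x) (ℕₚ.+-identityʳ e))
                     (≡.cong (sumR R) (Listₚ.map-cong (λ j → ≡.cong (pow R x) (ℕₚ.+-suc e j)) (upTo n))) ⟩
    pow R x e + (∑[ j ∈ upTo n ] pow R x (suc e ℕ.+ j))        ≈⟨ +-cong refl (∑-pow-upTo x (suc e) n) ⟩
    pow R x e + (x * pow R x e) * qint R x n
      ≈⟨ solve 3 (λ w x k → w :+ (x :* w) :* k := w :* (con 1 :+ x :* k)) refl (pow R x e) x (qint R x n) ⟩
    pow R x e * qint R x (suc n)                             ∎

  ∑-absorb-last : ∀ n (f : ℕ → Carrier) {h s y y′} → h ≈ f n → s ≈ ∑ (upTo n) f → y ≈ y′ →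
                  h + (s + y) ≈ (∑[ j ∈ upTo (suc n) ] f j) + y′
  ∑-absorb-last n f {h} {s} {y} {y′} h≈ s≈ y≈ = begin
    h + (s + y)              ≈⟨ sym (+-assoc _ _ _) ⟩
    h + s + y                ≈⟨ +-cong (trans (+-comm _ _) (+-cong s≈ h≈)) y≈ ⟩
    ∑ (upTo n) f + f n + y′  ≈⟨ +-cong (sym (∑-upTo-last n f)) refl ⟩
    ∑ (upTo (suc n)) f + y′  ∎

  ∑-absorb-head : ∀ n (f : ℕ → Carrier) {h x x′ s} → h ≈ f 0 → x ≈ x′ → s ≈ (∑[ j ∈ upTo n ] f (suc j)) →
                  h + (x + s) ≈ x′ + (∑[ j ∈ upTo (suc n) ] f j)
  ∑-absorb-head n f {h} {x} {x′} {s} h≈ x≈ s≈ = begin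
    h + (x + s)                              ≈⟨ solve 3 (λ a b c → a :+ (b :+ c) := b :+ (a :+ c)) refl h x s ⟩
    x + (h + s)                              ≈⟨ +-cong x≈ (+-cong h≈ s≈) ⟩
    x′ + (f 0 + (∑[ j ∈ upTo n ] f (suc j)))  ≈⟨ +-cong refl (sym (∑-upTo-head n f)) ⟩
    x′ + ∑ (upTo (suc n)) f                  ∎

  weight : (ℕ → ℕ → Carrier) → ColInt → CPerm → Carrier
  weight g p w = g (desAfter p w) (majAfter p w)

  -- Weights seen from the second letter: every later descent moves one position to the right.
  afterDescent afterAscent : (ℕ → ℕ → Carrier) → ℕ → ℕ → Carrier
  afterDescent g e k = g (suc e) (e ℕ.+ k)
  afterAscent g e k = g e (e ℕ.+ k)

  ∑-map-∷-descent : ∀ g p x vs → x <c p ≡ true → ∑ (map (x ∷_) vs) (weight g p) ≈ ∑ vs (weight (afterDescent g) x)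
  ∑-map-∷-descent g p x vs x<p =
    trans (∑-map (x ∷_) vs _) (∑-cong vs (λ v → reflexive (≡.cong₂ g (desAfter-descent v x<p) (majAfter-∷ p x v))))

  ∑-map-∷-ascent : ∀ g p x vs → x <c p ≡ false → ∑ (map (x ∷_) vs) (weight g p) ≈ ∑ vs (weight (afterAscent g) x)
  ∑-map-∷-ascent g p x vs x≮p =
    trans (∑-map (x ∷_) vs _) (∑-cong vs (λ v → reflexive (≡.cong₂ g (desAfter-ascent v x≮p) (majAfter-∷ p x v))))

  -- Inserting a letter above (top) or below (bottom) all letters of a word
  -- with d descents, major index m and length n: generating functions in (des, maj).
  topInsertionSum : (ℕ → ℕ → Carrier) → ℕ → ℕ → ℕ → Carrier
  topInsertionSum g d m n =
    (∑[ j ∈ upTo (suc d) ] g d (m ℕ.+ j)) + (∑[ j ∈ upTo (n ∸ d) ] g (suc d) (m ℕ.+ suc d ℕ.+ j))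

  bottomInsertionSum : (ℕ → ℕ → Carrier) → ℕ → ℕ → ℕ → Carrier
  bottomInsertionSum g d m n =
    (∑[ j ∈ upTo d ] g d (m ℕ.+ j)) + (∑[ j ∈ upTo (suc n ∸ d) ] g (suc d) (m ℕ.+ d ℕ.+ j))

  topInsertionSum-descent : ∀ g d m n →
    g (suc d) (suc d ℕ.+ (d ℕ.+ m)) + topInsertionSum (afterDescent g) d m n ≈ topInsertionSum g (suc d) (d ℕ.+ m) (suc n)
  topInsertionSum-descent g d m n =
    ∑-absorb-last (suc d) (λ j → g (suc d) (d ℕ.+ m ℕ.+ j))
      (reflexive (≡.cong (g (suc d)) (arith₁ d m)))
      (∑-cong (upTo (suc d)) (λ j → reflexive (≡.cong (g (suc d)) (arith₂ d m j))))
      (∑-cong (upTo (n ∸ d)) (λ j → reflexive (≡.cong (g (suc (suc d))) (arith₃ d m j))))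
    where
    arith₁ : ∀ d m → suc d ℕ.+ (d ℕ.+ m) ≡ d ℕ.+ m ℕ.+ suc d
    arith₁ = solve-∀
    arith₂ : ∀ d m j → d ℕ.+ (m ℕ.+ j) ≡ d ℕ.+ m ℕ.+ j
    arith₂ = solve-∀
    arith₃ : ∀ d m j → suc d ℕ.+ (m ℕ.+ suc d ℕ.+ j) ≡ d ℕ.+ m ℕ.+ suc (suc d) ℕ.+ j
    arith₃ = solve-∀

  topInsertionSum-ascent : ∀ g {d n} m → d ≤ n →
    g (suc d) (suc d ℕ.+ (d ℕ.+ m)) + topInsertionSum (afterAscent g) d m n ≈ topInsertionSum g d (d ℕ.+ m) (suc n)
  topInsertionSum-ascent g {d} {n} m d≤n = begin
    g (suc d) (suc d ℕ.+ (d ℕ.+ m)) + topInsertionSum (afterAscent g) d m n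
      ≈⟨ ∑-absorb-head (n ∸ d) f
           (reflexive (≡.cong (g (suc d)) (arith₁ d m)))
           (∑-cong (upTo (suc d)) (λ j → reflexive (≡.cong (g d) (arith₂ d m j))))
           (∑-cong (upTo (n ∸ d)) (λ j → reflexive (≡.cong (g (suc d)) (arith₃ d m j)))) ⟩
    (∑[ j ∈ upTo (suc d) ] g d (d ℕ.+ m ℕ.+ j)) + ∑ (upTo (suc (n ∸ d))) f
      ≡⟨ ≡.cong (λ l → (∑[ j ∈ upTo (suc d) ] g d (d ℕ.+ m ℕ.+ j)) + ∑ (upTo l) f) (ℕₚ.+-∸-assoc 1 d≤n) ⟨
    topInsertionSum g d (d ℕ.+ m) (suc n) ∎
    where
    f = λ j → g (suc d) (d ℕ.+ m ℕ.+ suc d ℕ.+ j)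
    arith₁ : ∀ d m → suc d ℕ.+ (d ℕ.+ m) ≡ d ℕ.+ m ℕ.+ suc d ℕ.+ 0
    arith₁ = solve-∀
    arith₂ : ∀ d m j → d ℕ.+ (m ℕ.+ j) ≡ d ℕ.+ m ℕ.+ j
    arith₂ = solve-∀
    arith₃ : ∀ d m j → suc d ℕ.+ (m ℕ.+ suc d ℕ.+ j) ≡ d ℕ.+ m ℕ.+ suc d ℕ.+ suc j
    arith₃ = solve-∀

  bottomInsertionSum-descent : ∀ g d m n →
    g (suc d) (d ℕ.+ (d ℕ.+ m)) + bottomInsertionSum (afterDescent g) d m n ≈ bottomInsertionSum g (suc d) (d ℕ.+ m) (suc n)
  bottomInsertionSum-descent g d m n =
    ∑-absorb-last d (λ j → g (suc d) (d ℕ.+ m ℕ.+ j))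
      (reflexive (≡.cong (g (suc d)) (arith₁ d m)))
      (∑-cong (upTo d) (λ j → reflexive (≡.cong (g (suc d)) (arith₂ d m j))))
      (∑-cong (upTo (suc n ∸ d)) (λ j → reflexive (≡.cong (g (suc (suc d))) (arith₃ d m j))))
    where
    arith₁ : ∀ d m → d ℕ.+ (d ℕ.+ m) ≡ d ℕ.+ m ℕ.+ d
    arith₁ = solve-∀
    arith₂ : ∀ d m j → d ℕ.+ (m ℕ.+ j) ≡ d ℕ.+ m ℕ.+ j
    arith₂ = solve-∀
    arith₃ : ∀ d m j → suc d ℕ.+ (m ℕ.+ d ℕ.+ j) ≡ d ℕ.+ m ℕ.+ suc d ℕ.+ j
    arith₃ = solve-∀

  bottomInsertionSum-ascent : ∀ g {d n} m → d ≤ n →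
    g (suc d) (d ℕ.+ (d ℕ.+ m)) + bottomInsertionSum (afterAscent g) d m n ≈ bottomInsertionSum g d (d ℕ.+ m) (suc n)
  bottomInsertionSum-ascent g {d} {n} m d≤n = begin
    g (suc d) (d ℕ.+ (d ℕ.+ m)) + bottomInsertionSum (afterAscent g) d m n
      ≈⟨ ∑-absorb-head (suc n ∸ d) f
           (reflexive (≡.cong (g (suc d)) (arith₁ d m)))
           (∑-cong (upTo d) (λ j → reflexive (≡.cong (g d) (arith₂ d m j))))
           (∑-cong (upTo (suc n ∸ d)) (λ j → reflexive (≡.cong (g (suc d)) (arith₃ d m j)))) ⟩
    (∑[ j ∈ upTo d ] g d (d ℕ.+ m ℕ.+ j)) + ∑ (upTo (suc (suc n ∸ d))) f
      ≡⟨ ≡.cong (λ l → (∑[ j ∈ upTo d ] g d (d ℕ.+ m ℕ.+ j)) + ∑ (upTo l) f) (ℕₚ.+-∸-assoc 1 (ℕₚ.m≤n⇒m≤1+n d≤n)) ⟨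
    bottomInsertionSum g d (d ℕ.+ m) (suc n) ∎
    where
    f = λ j → g (suc d) (d ℕ.+ m ℕ.+ d ℕ.+ j)
    arith₁ : ∀ d m → d ℕ.+ (d ℕ.+ m) ≡ d ℕ.+ m ℕ.+ d ℕ.+ 0
    arith₁ = solve-∀
    arith₂ : ∀ d m j → d ℕ.+ (m ℕ.+ j) ≡ d ℕ.+ m ℕ.+ j
    arith₂ = solve-∀
    arith₃ : ∀ d m j → suc d ℕ.+ (m ℕ.+ d ℕ.+ j) ≡ d ℕ.+ m ℕ.+ d ℕ.+ suc j
    arith₃ = solve-∀

  ∑-inserts-top : ∀ g {L} p w → L <c p ≡ false →
                  All (λ y → y <c L ≡ true) w → All (λ y → L <c y ≡ false) w →
                  ∑ (inserts L w) (weight g p) ≈ topInsertionSum g (desAfter p w) (majAfter p w) (length w)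
  ∑-inserts-top g p [] L≮p [] [] rewrite L≮p = sym (+-identityʳ _)
  ∑-inserts-top g {L} p (x ∷ xs) L≮p (x<L ∷ xs<L) (L≮x ∷ L≮xs) = cases (x <c p) ≡.refl
    where
    d′ = desAfter x xs
    m′ = majAfter x xs
    head : weight g p (L ∷ x ∷ xs) ≈ g (suc d′) (suc d′ ℕ.+ (d′ ℕ.+ m′))
    head = reflexive (≡.cong₂ g (≡.trans (desAfter-ascent (x ∷ xs) L≮p) (desAfter-descent xs x<L))
      (≡.trans (majAfter-∷ p L (x ∷ xs)) (≡.cong₂ ℕ._+_ (desAfter-descent xs x<L) (majAfter-∷ L x xs))))
    cases : ∀ b → x <c p ≡ b → ∑ (inserts L (x ∷ xs)) (weight g p)
                              ≈ topInsertionSum g (desAfter p (x ∷ xs)) (majAfter p (x ∷ xs)) (suc (length xs))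
    cases true x<p = begin
      weight g p (L ∷ x ∷ xs) + ∑ (map (x ∷_) (inserts L xs)) (weight g p)
        ≈⟨ +-cong head (trans (∑-map-∷-descent g p x (inserts L xs) x<p)
                              (∑-inserts-top (afterDescent g) x xs L≮x xs<L L≮xs)) ⟩
      g (suc d′) (suc d′ ℕ.+ (d′ ℕ.+ m′)) + topInsertionSum (afterDescent g) d′ m′ (length xs)
        ≈⟨ topInsertionSum-descent g d′ m′ (length xs) ⟩
      topInsertionSum g (suc d′) (d′ ℕ.+ m′) (suc (length xs))
        ≡⟨ ≡.cong₂ (λ d m → topInsertionSum g d m (suc (length xs))) (desAfter-descent xs x<p) (majAfter-∷ p x xs) ⟨
      topInsertionSum g (desAfter p (x ∷ xs)) (majAfter p (x ∷ xs)) (suc (length xs)) ∎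
    cases false x≮p = begin
      weight g p (L ∷ x ∷ xs) + ∑ (map (x ∷_) (inserts L xs)) (weight g p)
        ≈⟨ +-cong head (trans (∑-map-∷-ascent g p x (inserts L xs) x≮p)
                              (∑-inserts-top (afterAscent g) x xs L≮x xs<L L≮xs)) ⟩
      g (suc d′) (suc d′ ℕ.+ (d′ ℕ.+ m′)) + topInsertionSum (afterAscent g) d′ m′ (length xs)
        ≈⟨ topInsertionSum-ascent g m′ (length-desList≤ 0 x xs) ⟩
      topInsertionSum g d′ (d′ ℕ.+ m′) (suc (length xs))
        ≡⟨ ≡.cong₂ (λ d m → topInsertionSum g d m (suc (length xs))) (desAfter-ascent xs x≮p) (majAfter-∷ p x xs) ⟨
      topInsertionSum g (desAfter p (x ∷ xs)) (majAfter p (x ∷ xs)) (suc (length xs)) ∎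

  ∑-inserts-bottom : ∀ g {L} p w → L <c p ≡ true →
                     All (λ y → y <c L ≡ false) w → All (λ y → L <c y ≡ true) w →
                     ∑ (inserts L w) (weight g p) ≈ bottomInsertionSum g (desAfter p w) (majAfter p w) (length w)
  ∑-inserts-bottom g p [] L<p [] [] rewrite L<p = sym (+-identityˡ _)
  ∑-inserts-bottom g {L} p (x ∷ xs) L<p (x≮L ∷ xs≮L) (L<x ∷ L<xs) = cases (x <c p) ≡.refl
    where
    d′ = desAfter x xs
    m′ = majAfter x xs
    head : weight g p (L ∷ x ∷ xs) ≈ g (suc d′) (d′ ℕ.+ (d′ ℕ.+ m′))
    head = reflexive (≡.cong₂ g (≡.trans (desAfter-descent (x ∷ xs) L<p) (≡.cong suc (desAfter-ascent xs x≮L)))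
      (≡.trans (majAfter-∷ p L (x ∷ xs)) (≡.cong₂ ℕ._+_ (desAfter-ascent xs x≮L) (majAfter-∷ L x xs))))
    cases : ∀ b → x <c p ≡ b → ∑ (inserts L (x ∷ xs)) (weight g p)
                              ≈ bottomInsertionSum g (desAfter p (x ∷ xs)) (majAfter p (x ∷ xs)) (suc (length xs))
    cases true x<p = begin
      weight g p (L ∷ x ∷ xs) + ∑ (map (x ∷_) (inserts L xs)) (weight g p)
        ≈⟨ +-cong head (trans (∑-map-∷-descent g p x (inserts L xs) x<p)
                              (∑-inserts-bottom (afterDescent g) x xs L<x xs≮L L<xs)) ⟩
      g (suc d′) (d′ ℕ.+ (d′ ℕ.+ m′)) + bottomInsertionSum (afterDescent g) d′ m′ (length xs)
        ≈⟨ bottomInsertionSum-descent g d′ m′ (length xs) ⟩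
      bottomInsertionSum g (suc d′) (d′ ℕ.+ m′) (suc (length xs))
        ≡⟨ ≡.cong₂ (λ d m → bottomInsertionSum g d m (suc (length xs))) (desAfter-descent xs x<p) (majAfter-∷ p x xs) ⟨
      bottomInsertionSum g (desAfter p (x ∷ xs)) (majAfter p (x ∷ xs)) (suc (length xs)) ∎
    cases false x≮p = begin
      weight g p (L ∷ x ∷ xs) + ∑ (map (x ∷_) (inserts L xs)) (weight g p)
        ≈⟨ +-cong head (trans (∑-map-∷-ascent g p x (inserts L xs) x≮p)
                              (∑-inserts-bottom (afterAscent g) x xs L<x xs≮L L<xs)) ⟩
      g (suc d′) (d′ ℕ.+ (d′ ℕ.+ m′)) + bottomInsertionSum (afterAscent g) d′ m′ (length xs)
        ≈⟨ bottomInsertionSum-ascent g m′ (length-desList≤ 0 x xs) ⟩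
      bottomInsertionSum g d′ (d′ ℕ.+ m′) (suc (length xs))
        ≡⟨ ≡.cong₂ (λ d m → bottomInsertionSum g d m (suc (length xs))) (desAfter-ascent xs x≮p) (majAfter-∷ p x xs) ⟨
      bottomInsertionSum g (desAfter p (x ∷ xs)) (majAfter p (x ∷ xs)) (suc (length xs)) ∎

  ∑-colorings-suc : ∀ r n (h : List ℕ → Carrier) →
                    ∑ (colorings r (suc n)) h ≈ (∑[ cs ∈ colorings r n ] ∑[ c ∈ upTo r ] h (c ∷ cs))
  ∑-colorings-suc r n h = trans (∑-concatMap (λ cs → map (_∷ cs) (upTo r)) (colorings r n) h)
                                (∑-cong (colorings r n) (λ cs → ∑-map (_∷ cs) (upTo r) h))

  ∑-G : ∀ r n (h : CPerm → Carrier) → ∑ (G r n) h ≈ (∑[ σ ∈ perms n ] ∑[ cs ∈ colorings r n ] h (zip σ cs))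
  ∑-G r n h = trans (∑-concatMap (λ σ → map (zip σ) (colorings r n)) (perms n) h)
                    (∑-cong (perms n) (λ σ → ∑-map (zip σ) (colorings r n) h))

  ∑-insertions-zip : ∀ r x σ (f : CPerm → Carrier) →
    (∑[ σ′ ∈ insertions x σ ] ∑[ cs ∈ colorings r (suc (length σ)) ] f (zip σ′ cs))
      ≈ (∑[ cs ∈ colorings r (length σ) ] ∑[ c ∈ upTo r ] ∑ (inserts (x , c) (zip σ cs)) f)
  ∑-insertions-zip r x [] f =
    +-cong (trans (∑-colorings-suc r 0 _) (trans (+-identityʳ _) (∑-cong (upTo r) (λ c → sym (+-identityʳ _))))) refl
  ∑-insertions-zip r x (y ∷ ys) f = begin
    (∑[ cs ∈ colorings r (suc (suc n)) ] f (zip (x ∷ y ∷ ys) cs))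
      + (∑[ σ′ ∈ map (y ∷_) (insertions x ys) ] ∑[ cs ∈ colorings r (suc (suc n)) ] f (zip σ′ cs))
      ≈⟨ +-cong (trans (∑-colorings-suc r (suc n) _) (∑-colorings-suc r n _)) insert-later ⟩
    (∑[ cs ∈ colorings r n ] ∑[ d ∈ upTo r ] ∑[ c ∈ upTo r ] f ((x , c) ∷ (y , d) ∷ zip ys cs))
      + (∑[ cs ∈ colorings r n ] ∑[ d ∈ upTo r ] ∑[ c ∈ upTo r ] ∑ (inserts (x , c) (zip ys cs)) (f ∘ ((y , d) ∷_)))
      ≈⟨ sym (∑-+ (colorings r n) _ _) ⟩
    (∑[ cs ∈ colorings r n ] ((∑[ d ∈ upTo r ] ∑[ c ∈ upTo r ] f ((x , c) ∷ (y , d) ∷ zip ys cs))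
      + (∑[ d ∈ upTo r ] ∑[ c ∈ upTo r ] ∑ (inserts (x , c) (zip ys cs)) (f ∘ ((y , d) ∷_)))))
      ≈⟨ ∑-cong (colorings r n) (λ cs → sym (trans (∑-cong (upTo r) (λ d → ∑-+ (upTo r) _ _)) (∑-+ (upTo r) _ _))) ⟩
    (∑[ cs ∈ colorings r n ] ∑[ d ∈ upTo r ] ∑[ c ∈ upTo r ]
       (f ((x , c) ∷ (y , d) ∷ zip ys cs) + ∑ (inserts (x , c) (zip ys cs)) (f ∘ ((y , d) ∷_))))
      ≈⟨ ∑-cong (colorings r n) (λ cs → ∑-cong (upTo r) (λ d → ∑-cong (upTo r) (λ c →
           +-cong refl (sym (∑-map ((y , d) ∷_) (inserts (x , c) (zip ys cs)) f))))) ⟩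
    (∑[ cs ∈ colorings r n ] ∑[ d ∈ upTo r ] ∑[ c ∈ upTo r ] ∑ (inserts (x , c) (zip (y ∷ ys) (d ∷ cs))) f)
      ≈⟨ sym (∑-colorings-suc r n _) ⟩
    (∑[ cs ∈ colorings r (suc n) ] ∑[ c ∈ upTo r ] ∑ (inserts (x , c) (zip (y ∷ ys) cs)) f) ∎
    where
    n = length ys
    insert-later :
      (∑[ σ′ ∈ map (y ∷_) (insertions x ys) ] ∑[ cs ∈ colorings r (suc (suc n)) ] f (zip σ′ cs))
        ≈ (∑[ cs ∈ colorings r n ] ∑[ d ∈ upTo r ] ∑[ c ∈ upTo r ] ∑ (inserts (x , c) (zip ys cs)) (f ∘ ((y , d) ∷_)))
    insert-later = begin
      (∑[ σ′ ∈ map (y ∷_) (insertions x ys) ] ∑[ cs ∈ colorings r (suc (suc n)) ] f (zip σ′ cs))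
        ≈⟨ ∑-map (y ∷_) (insertions x ys) _ ⟩
      (∑[ σ ∈ insertions x ys ] ∑[ cs ∈ colorings r (suc (suc n)) ] f (zip (y ∷ σ) cs))
        ≈⟨ ∑-cong (insertions x ys) (λ σ → trans (∑-colorings-suc r (suc n) _) (∑-comm (colorings r (suc n)) (upTo r) _)) ⟩
      (∑[ σ ∈ insertions x ys ] ∑[ d ∈ upTo r ] ∑[ cs ∈ colorings r (suc n) ] f ((y , d) ∷ zip σ cs))
        ≈⟨ ∑-comm (insertions x ys) (upTo r) _ ⟩
      (∑[ d ∈ upTo r ] ∑[ σ ∈ insertions x ys ] ∑[ cs ∈ colorings r (suc n) ] f ((y , d) ∷ zip σ cs))
        ≈⟨ ∑-cong (upTo r) (λ d → ∑-insertions-zip r x ys (f ∘ ((y , d) ∷_))) ⟩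
      (∑[ d ∈ upTo r ] ∑[ cs ∈ colorings r n ] ∑[ c ∈ upTo r ] ∑ (inserts (x , c) (zip ys cs)) (f ∘ ((y , d) ∷_)))
        ≈⟨ ∑-comm (upTo r) (colorings r n) _ ⟩
      (∑[ cs ∈ colorings r n ] ∑[ d ∈ upTo r ] ∑[ c ∈ upTo r ] ∑ (inserts (x , c) (zip ys cs)) (f ∘ ((y , d) ∷_))) ∎

  ∑-G-suc : ∀ r n (f : CPerm → Carrier) →
            ∑ (G r (suc n)) f ≈ (∑[ γ ∈ G r n ] ∑[ c ∈ upTo r ] ∑ (inserts (suc n , c) γ) f)
  ∑-G-suc r n f = begin
    ∑ (G r (suc n)) f
      ≈⟨ ∑-G r (suc n) f ⟩
    (∑[ σ′ ∈ perms (suc n) ] ∑[ cs ∈ colorings r (suc n) ] f (zip σ′ cs))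
      ≈⟨ ∑-concatMap (insertions (suc n)) (perms n) _ ⟩
    (∑[ σ ∈ perms n ] ∑[ σ′ ∈ insertions (suc n) σ ] ∑[ cs ∈ colorings r (suc n) ] f (zip σ′ cs))
      ≈⟨ ∑-cong-All (perms-length n) (λ {σ} σ≡n → ≡.subst (λ m →
           (∑[ σ′ ∈ insertions (suc n) σ ] ∑[ cs ∈ colorings r (suc m) ] f (zip σ′ cs))
             ≈ (∑[ cs ∈ colorings r m ] ∑[ c ∈ upTo r ] ∑ (inserts (suc n , c) (zip σ cs)) f))
           σ≡n (∑-insertions-zip r (suc n) σ f)) ⟩
    (∑[ σ ∈ perms n ] ∑[ cs ∈ colorings r n ] ∑[ c ∈ upTo r ] ∑ (inserts (suc n , c) (zip σ cs)) f)
      ≈⟨ sym (∑-G r n _) ⟩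
    (∑[ γ ∈ G r n ] ∑[ c ∈ upTo r ] ∑ (inserts (suc n , c) γ) f) ∎

  module _ (q : Carrier) where

    poch-vanish : ∀ {m j} → m < j → poch R q m j ≈ 0#
    poch-vanish {zero} {suc j} _ = refl
    poch-vanish {suc m} {suc j} (s≤s m<j) = begin
      poch R q m (suc j) - pow R q m * poch R q m j  ≈⟨ +-cong (poch-vanish (ℕₚ.m<n⇒m<1+n m<j))
                                                         (-‿cong (trans (*-cong refl (poch-vanish m<j)) (zeroʳ _))) ⟩
      0# - 0#                                        ≈⟨ -‿inverseʳ 0# ⟩
      0#                                             ∎

    poch-suc-suc : ∀ m j → poch R q (suc m) (suc j) + pow R q m * poch R q m j ≈ poch R q m (suc j)
    poch-suc-suc m j = //-rightDividesˡ (pow R q m * poch R q m j) (poch R q m (suc j))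

    tCoeff : ℕ → ℕ → ℕ → Carrier
    tCoeff k d m = ⟦ d ≡ᵇ k ⟧* pow R q m

    ∑-⟦⟧*-pow : ∀ b e n → (∑[ j ∈ upTo n ] ⟦ b ⟧* pow R q (e ℕ.+ j)) ≈ ⟦ b ⟧* (pow R q e * qint R q n)
    ∑-⟦⟧*-pow b e n = trans (∑-⟦⟧* (upTo n) b _) (⟦⟧*-cong b (∑-pow-upTo q e n))

    PochRatio : ℕ → ℕ → Set ℓ
    PochRatio m i = qint R q (suc i) * poch R q m (suc i) + pow R q i * qint R q (m ∸ i) * poch R q m i ≈ 0#

    pochRatio-vanish : ∀ {m i} → m ≤ i → PochRatio m i
    pochRatio-vanish {m} {i} m≤i = begin
      qint R q (suc i) * poch R q m (suc i) + pow R q i * qint R q (m ∸ i) * poch R q m i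
        ≡⟨ ≡.cong (λ k → qint R q (suc i) * poch R q m (suc i) + pow R q i * qint R q k * poch R q m i) (ℕₚ.m≤n⇒m∸n≡0 m≤i) ⟩
      qint R q (suc i) * poch R q m (suc i) + pow R q i * 0# * poch R q m i
        ≈⟨ +-cong (*-cong refl (poch-vanish (s≤s m≤i))) refl ⟩
      qint R q (suc i) * 0# + pow R q i * 0# * poch R q m i
        ≈⟨ solve 3 (λ a b c → a :* con 0 :+ b :* con 0 :* c := con 0) refl _ _ _ ⟩
      0# ∎

    pochRatio-suc-zero : ∀ {m} → PochRatio m 0 → PochRatio (suc m) 0
    pochRatio-suc-zero {m} ratio = begin
      qint R q 1 * D + 1# * qint R q (suc m) * P₀
        ≈⟨ +-cong refl (*-cong (*-cong refl (qint-sucʳ q m)) refl) ⟩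
      qint R q 1 * D + 1# * (qint R q m + pow R q m) * P₀
        ≈⟨ solve 5 (λ q D Qₘ Qᵐ P₀ → (con 1 :+ q :* con 0) :* D :+ con 1 :* (Qₘ :+ Qᵐ) :* P₀
                      := (con 1 :+ q :* con 0) :* (D :+ Qᵐ :* P₀) :+ con 1 :* Qₘ :* P₀)
             refl q D (qint R q m) (pow R q m) P₀ ⟩
      qint R q 1 * (D + pow R q m * P₀) + 1# * qint R q m * P₀
        ≈⟨ +-cong (*-cong refl (poch-suc-suc m 0)) refl ⟩
      qint R q 1 * poch R q m 1 + 1# * qint R q m * P₀
        ≈⟨ ratio ⟩
      0# ∎
      where
      D = poch R q (suc m) 1
      P₀ = poch R q m 0

    -- Both the left-hand side plus z and z itself equal q^m c_(i+1): the first by the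
    -- recurrence of (t;q)_(m+1) and the ratio at i+1, the second by the ratio at i.
    pochRatio-suc-suc : ∀ {m i} → suc i ≤ m → PochRatio m (suc i) → PochRatio m i → PochRatio (suc m) (suc i)
    pochRatio-suc-suc {m} {i} i<m ratio₁ ratio₀ = ∙-cancelʳ z _ 0# (trans lhs+z (sym (trans (+-identityˡ z) z≈)))
      where
      e = m ∸ suc i
      m∸i≡1+e : m ∸ i ≡ suc e
      m∸i≡1+e = ℕₚ.+-∸-assoc 1 i<m
      A = poch R q m (suc (suc i))
      B = poch R q m (suc i)
      C = poch R q m i
      Qᵐ = pow R q m
      z = qint R q (suc (suc i)) * (Qᵐ * B) + pow R q (suc i) * qint R q (suc e) * (Qᵐ * C)
      z≈ : z ≈ Qᵐ * B
      z≈ = begin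
        (1# + q * qint R q (suc i)) * (Qᵐ * B) + (q * pow R q i) * qint R q (suc e) * (Qᵐ * C)
          ≈⟨ solve 7 (λ q Q₁ Qⁱ E M B C → (con 1 :+ q :* Q₁) :* (M :* B) :+ (q :* Qⁱ) :* E :* (M :* C)
                         := M :* B :+ M :* q :* (Q₁ :* B :+ Qⁱ :* E :* C))
               refl q (qint R q (suc i)) (pow R q i) (qint R q (suc e)) Qᵐ B C ⟩
        Qᵐ * B + Qᵐ * q * (qint R q (suc i) * B + pow R q i * qint R q (suc e) * C)
          ≈⟨ +-cong refl (*-cong refl (≡.subst (λ k → qint R q (suc i) * B + pow R q i * qint R q k * C ≈ 0#) m∸i≡1+e ratio₀)) ⟩
        Qᵐ * B + Qᵐ * q * 0#
          ≈⟨ solve 3 (λ M B q → M :* B :+ M :* q :* con 0 := M :* B) refl Qᵐ B q ⟩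
        Qᵐ * B ∎
      lhs+z : qint R q (suc (suc i)) * poch R q (suc m) (suc (suc i))
                + pow R q (suc i) * qint R q (m ∸ i) * poch R q (suc m) (suc i) + z ≈ Qᵐ * B
      lhs+z = begin
        qint R q (suc (suc i)) * poch R q (suc m) (suc (suc i))
          + pow R q (suc i) * qint R q (m ∸ i) * poch R q (suc m) (suc i) + z
          ≡⟨ ≡.cong (λ k → qint R q (suc (suc i)) * poch R q (suc m) (suc (suc i))
                            + pow R q (suc i) * qint R q k * poch R q (suc m) (suc i) + z) m∸i≡1+e ⟩
        qint R q (suc (suc i)) * poch R q (suc m) (suc (suc i))
          + pow R q (suc i) * qint R q (suc e) * poch R q (suc m) (suc i) + z
          ≈⟨ solve 8 (λ Q₂ Dᵃ Qⁱ E Dᵇ M B C → Q₂ :* Dᵃ :+ Qⁱ :* E :* Dᵇ :+ (Q₂ :* (M :* B) :+ Qⁱ :* E :* (M :* C))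
                          := Q₂ :* (Dᵃ :+ M :* B) :+ Qⁱ :* E :* (Dᵇ :+ M :* C))
               refl (qint R q (suc (suc i))) (poch R q (suc m) (suc (suc i))) (pow R q (suc i)) (qint R q (suc e))
                    (poch R q (suc m) (suc i)) Qᵐ B C ⟩
        qint R q (suc (suc i)) * (poch R q (suc m) (suc (suc i)) + Qᵐ * B)
          + pow R q (suc i) * qint R q (suc e) * (poch R q (suc m) (suc i) + Qᵐ * C)
          ≈⟨ +-cong (*-cong refl (poch-suc-suc m (suc i))) (*-cong refl (poch-suc-suc m i)) ⟩
        qint R q (suc (suc i)) * A + pow R q (suc i) * qint R q (suc e) * B
          ≈⟨ +-cong refl (*-cong (*-cong refl (qint-sucʳ q e)) refl) ⟩
        qint R q (suc (suc i)) * A + pow R q (suc i) * (qint R q e + pow R q e) * B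
          ≈⟨ solve 5 (λ X Qⁱ E W B → X :+ Qⁱ :* (E :+ W) :* B := (X :+ Qⁱ :* E :* B) :+ (Qⁱ :* W) :* B)
               refl (qint R q (suc (suc i)) * A) (pow R q (suc i)) (qint R q e) (pow R q e) B ⟩
        (qint R q (suc (suc i)) * A + pow R q (suc i) * qint R q e * B) + (pow R q (suc i) * pow R q e) * B
          ≈⟨ +-cong ratio₁ (*-cong (trans (sym (pow-+ q (suc i) e)) (reflexive (≡.cong (pow R q) (ℕₚ.m+[n∸m]≡n i<m)))) refl) ⟩
        0# + Qᵐ * B
          ≈⟨ +-identityˡ _ ⟩
        Qᵐ * B ∎

    poch-ratio : ∀ m i → PochRatio m i
    poch-ratio zero i = pochRatio-vanish {0} {i} z≤n
    poch-ratio (suc m) zero = pochRatio-suc-zero {m} (poch-ratio m 0)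
    poch-ratio (suc m) (suc i) with suc i ℕₚ.≤? m
    ... | yes i<m = pochRatio-suc-suc {m} {i} i<m (poch-ratio m (suc i)) (poch-ratio m i)
    ... | no i≮m = pochRatio-vanish {suc m} {suc i} (s≤s (ℕₚ.≤-pred (ℕₚ.≰⇒> i≮m)))

  module _ (q α : Carrier) where

    X : ℕ → Carrier
    X k = qint R q (suc k) + α * qint R q k

    Y : ℕ → ℕ → Carrier
    Y n d = (1# + α) * qint R q (suc n) - X d

    X-+ : ∀ m s → X (m ℕ.+ s) ≈ (1# + α) * qint R q m + pow R q m * X s
    X-+ m s = begin
      qint R q (suc (m ℕ.+ s)) + α * qint R q (m ℕ.+ s)
        ≡⟨ ≡.cong (λ k → qint R q k + α * qint R q (m ℕ.+ s)) (≡.sym (ℕₚ.+-suc m s)) ⟩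
      qint R q (m ℕ.+ suc s) + α * qint R q (m ℕ.+ s)
        ≈⟨ +-cong (qint-+ q m (suc s)) (*-cong refl (qint-+ q m s)) ⟩
      (qint R q m + pow R q m * qint R q (suc s)) + α * (qint R q m + pow R q m * qint R q s)
        ≈⟨ solve 5 (λ a Qₘ Qᵐ Q₁ Q₀ → (Qₘ :+ Qᵐ :* Q₁) :+ a :* (Qₘ :+ Qᵐ :* Q₀)
                      := (con 1 :+ a) :* Qₘ :+ Qᵐ :* (Q₁ :+ a :* Q₀))
             refl α (qint R q m) (pow R q m) (qint R q (suc s)) (qint R q s) ⟩
      (1# + α) * qint R q m + pow R q m * X s ∎

    X-shift : ∀ s j → X (s ℕ.+ j) ≈ X s + pow R q s * qint R q j * (q + α)
    X-shift s j = begin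
      qint R q (suc s ℕ.+ j) + α * qint R q (s ℕ.+ j)
        ≈⟨ +-cong (qint-+ q (suc s) j) (*-cong refl (qint-+ q s j)) ⟩
      (qint R q (suc s) + (q * pow R q s) * qint R q j) + α * (qint R q s + pow R q s * qint R q j)
        ≈⟨ solve 6 (λ Q₁ q Qˢ J a Q₀ → (Q₁ :+ (q :* Qˢ) :* J) :+ a :* (Q₀ :+ Qˢ :* J)
                      := (Q₁ :+ a :* Q₀) :+ Qˢ :* J :* (q :+ a))
             refl (qint R q (suc s)) q (pow R q s) (qint R q j) α (qint R q s) ⟩
      X s + pow R q s * qint R q j * (q + α) ∎

    X-split : ∀ {m} s i → i ≤ m →
              (1# + α) * qint R q m + pow R q m * X s ≈ X (s ℕ.+ i) + pow R q (s ℕ.+ i) * qint R q (m ∸ i) * (q + α)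
    X-split {m} s i i≤m = begin
      (1# + α) * qint R q m + pow R q m * X s  ≈⟨ sym (X-+ m s) ⟩
      X (m ℕ.+ s)                             ≡⟨ ≡.cong X m+s≡ ⟩
      X (s ℕ.+ i ℕ.+ (m ∸ i))                 ≈⟨ X-shift (s ℕ.+ i) (m ∸ i) ⟩
      X (s ℕ.+ i) + pow R q (s ℕ.+ i) * qint R q (m ∸ i) * (q + α) ∎
      where
      m+s≡ : m ℕ.+ s ≡ s ℕ.+ i ℕ.+ (m ∸ i)
      m+s≡ = ≡.trans (ℕₚ.+-comm m s) (≡.trans (≡.cong (s ℕ.+_) (≡.sym (ℕₚ.m+[n∸m]≡n i≤m))) (≡.sym (ℕₚ.+-assoc s i (m ∸ i))))

    Y+X : ∀ n d → Y n d + X d ≈ (1# + α) * qint R q (suc n)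
    Y+X n d = //-rightDividesˡ (X d) _

    Y-split : ∀ {n d} → d ≤ n → Y n d ≈ pow R q (suc d) * qint R q (n ∸ d) + α * (pow R q d * qint R q (suc n ∸ d))
    Y-split {n} {d} d≤n = ∙-cancelʳ (X d) _ _ (trans (Y+X n d) (sym (begin
      pow R q (suc d) * qint R q (n ∸ d) + α * (pow R q d * qint R q (suc n ∸ d)) + X d
        ≈⟨ solve 7 (λ Qᵈ⁺ E a Qᵈ E⁺ Q₁ Q₀ → Qᵈ⁺ :* E :+ a :* (Qᵈ :* E⁺) :+ (Q₁ :+ a :* Q₀)
                      := (Q₁ :+ Qᵈ⁺ :* E) :+ a :* (Q₀ :+ Qᵈ :* E⁺))
             refl (pow R q (suc d)) (qint R q (n ∸ d)) α (pow R q d) (qint R q (suc n ∸ d)) (qint R q (suc d)) (qint R q d) ⟩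
      (qint R q (suc d) + pow R q (suc d) * qint R q (n ∸ d)) + α * (qint R q d + pow R q d * qint R q (suc n ∸ d))
        ≈⟨ +-cong (sym (qint-+ q (suc d) (n ∸ d))) (*-cong refl (sym (qint-+ q d (suc n ∸ d)))) ⟩
      qint R q (suc d ℕ.+ (n ∸ d)) + α * qint R q (d ℕ.+ (suc n ∸ d))
        ≡⟨ ≡.cong₂ (λ k l → qint R q k + α * qint R q l)
                   (≡.cong suc (ℕₚ.m+[n∸m]≡n d≤n)) (ℕₚ.m+[n∸m]≡n (ℕₚ.m≤n⇒m≤1+n d≤n)) ⟩
      qint R q (suc n) + α * qint R q (suc n)
        ≈⟨ solve 2 (λ Q a → Q :+ a :* Q := (con 1 :+ a) :* Q) refl (qint R q (suc n)) α ⟩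
      (1# + α) * qint R q (suc n) ∎)))

    insertStep : ℕ → (ℕ → Carrier) → ℕ → Carrier
    insertStep n f zero = f 0 * X 0
    insertStep n f (suc k) = f (suc k) * X (suc k) + f k * Y n k

    insertStep-cong : ∀ n {f g : ℕ → Carrier} → (∀ k → f k ≈ g k) → ∀ k → insertStep n f k ≈ insertStep n g k
    insertStep-cong n f≈g zero = *-cong (f≈g 0) refl
    insertStep-cong n f≈g (suc k) = +-cong (*-cong (f≈g (suc k)) refl) (*-cong (f≈g k) refl)

    ∑-insertStep : ∀ n {A : Set} (xs : List A) (f : A → ℕ → Carrier) k →
                   (∑[ x ∈ xs ] insertStep n (f x) k) ≈ insertStep n (λ j → ∑[ x ∈ xs ] f x j) k
    ∑-insertStep n xs f zero = ∑-*ʳ xs (X 0) (λ x → f x 0)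
    ∑-insertStep n xs f (suc k) =
      trans (∑-+ xs _ _) (+-cong (∑-*ʳ xs (X (suc k)) (λ x → f x (suc k))) (∑-*ʳ xs (Y n k) (λ x → f x k)))

    insertStep-monomial : ∀ n d x k → ⟦ d ≡ᵇ k ⟧* (x * X d) + ⟦ suc d ≡ᵇ k ⟧* (x * Y n d) ≈ insertStep n (λ j → ⟦ d ≡ᵇ j ⟧* x) k
    insertStep-monomial n d x zero = trans (+-identityʳ _) (⟦≡ᵇ⟧*-subst d 0 X x)
    insertStep-monomial n d x (suc k) = +-cong (⟦≡ᵇ⟧*-subst d (suc k) X x) (⟦≡ᵇ⟧*-subst d k (Y n) x)

    insertionSums-monomial : ∀ k {d n} m A → d ≤ n →
      topInsertionSum (tCoeff q k) d m n * A + bottomInsertionSum (tCoeff q k) d m n * (α * A)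
        ≈ insertStep n (λ j → ⟦ d ≡ᵇ j ⟧* (pow R q m * A)) k
    insertionSums-monomial k {d} {n} m A d≤n = begin
      topInsertionSum (tCoeff q k) d m n * A + bottomInsertionSum (tCoeff q k) d m n * (α * A)
        ≈⟨ +-cong (*-cong (+-cong (∑-⟦⟧*-pow q b₁ m (suc d)) (∑-⟦⟧*-pow q b₂ (m ℕ.+ suc d) (n ∸ d))) refl)
                  (*-cong (+-cong (∑-⟦⟧*-pow q b₁ m d) (∑-⟦⟧*-pow q b₂ (m ℕ.+ d) (suc n ∸ d))) refl) ⟩
      (⟦ b₁ ⟧* (Qᵐ * qint R q (suc d)) + ⟦ b₂ ⟧* (pow R q (m ℕ.+ suc d) * qint R q (n ∸ d))) * A
        + (⟦ b₁ ⟧* (Qᵐ * qint R q d) + ⟦ b₂ ⟧* (pow R q (m ℕ.+ d) * qint R q (suc n ∸ d))) * (α * A)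
        ≈⟨ ⟦⟧*-pair b₁ b₂ _ _ _ _ A (α * A) ⟩
      ⟦ b₁ ⟧* (Qᵐ * qint R q (suc d) * A + Qᵐ * qint R q d * (α * A))
        + ⟦ b₂ ⟧* (pow R q (m ℕ.+ suc d) * qint R q (n ∸ d) * A + pow R q (m ℕ.+ d) * qint R q (suc n ∸ d) * (α * A))
        ≈⟨ +-cong (⟦⟧*-cong b₁ keep-descents) (⟦⟧*-cong b₂ new-descent) ⟩
      ⟦ b₁ ⟧* (Qᵐ * A * X d) + ⟦ b₂ ⟧* (Qᵐ * A * Y n d)
        ≈⟨ insertStep-monomial n d (Qᵐ * A) k ⟩
      insertStep n (λ j → ⟦ d ≡ᵇ j ⟧* (Qᵐ * A)) k ∎
      where
      Qᵐ = pow R q m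
      b₁ = d ≡ᵇ k
      b₂ = suc d ≡ᵇ k
      keep-descents : Qᵐ * qint R q (suc d) * A + Qᵐ * qint R q d * (α * A) ≈ Qᵐ * A * X d
      keep-descents = solve 5 (λ Qᵐ Q₁ Q₀ A a → Qᵐ :* Q₁ :* A :+ Qᵐ :* Q₀ :* (a :* A) := Qᵐ :* A :* (Q₁ :+ a :* Q₀))
                        refl Qᵐ (qint R q (suc d)) (qint R q d) A α
      new-descent : pow R q (m ℕ.+ suc d) * qint R q (n ∸ d) * A + pow R q (m ℕ.+ d) * qint R q (suc n ∸ d) * (α * A)
                      ≈ Qᵐ * A * Y n d
      new-descent = begin
        pow R q (m ℕ.+ suc d) * qint R q (n ∸ d) * A + pow R q (m ℕ.+ d) * qint R q (suc n ∸ d) * (α * A)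
          ≈⟨ +-cong (*-cong (*-cong (pow-+ q m (suc d)) refl) refl) (*-cong (*-cong (pow-+ q m d) refl) refl) ⟩
        Qᵐ * pow R q (suc d) * qint R q (n ∸ d) * A + Qᵐ * pow R q d * qint R q (suc n ∸ d) * (α * A)
          ≈⟨ solve 7 (λ Qᵐ Qᵈ⁺ E A Qᵈ E⁺ a → Qᵐ :* Qᵈ⁺ :* E :* A :+ Qᵐ :* Qᵈ :* E⁺ :* (a :* A)
                          := Qᵐ :* A :* (Qᵈ⁺ :* E :+ a :* (Qᵈ :* E⁺)))
               refl Qᵐ (pow R q (suc d)) (qint R q (n ∸ d)) A (pow R q d) (qint R q (suc n ∸ d)) α ⟩
        Qᵐ * A * (pow R q (suc d) * qint R q (n ∸ d) + α * (pow R q d * qint R q (suc n ∸ d)))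
          ≈⟨ *-cong refl (Y-split d≤n) ⟨
        Qᵐ * A * Y n d ∎

    seriesCoeff : ℕ → ℕ → Carrier
    seriesCoeff n = conv R (poch R q (suc n)) (λ j → pow R (X j) n)

    seriesCoeff-zero : ∀ k → seriesCoeff 0 k ≈ ⟦ 0 ≡ᵇ k ⟧* 1#
    seriesCoeff-zero zero = trans (+-identityʳ _) (*-identityʳ 1#)
    seriesCoeff-zero (suc k) = begin
      ∑[ j ∈ upTo (suc (suc k)) ] poch R q 1 j * 1#
        ≈⟨ trans (∑-upTo-head (suc k) _) (+-cong refl (∑-upTo-head k _)) ⟩
      1# * 1# + ((0# - 1# * 1#) * 1# + (∑[ j ∈ upTo k ] poch R q 1 (suc (suc j)) * 1#))
        ≈⟨ +-cong refl (+-cong refl (trans (∑-cong (upTo k) (λ j → trans (*-cong (poch-vanish q {1} {suc (suc j)} (s≤s (s≤s z≤n))) refl) (zeroˡ _)))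
                                           (∑-zero (upTo k)))) ⟩
      1# * 1# + ((0# - 1# * 1#) * 1# + 0#)
        ≈⟨ solve 2 (λ u v → v :+ (u :* con 1 :+ con 0) := u :+ v) refl (0# - 1# * 1#) (1# * 1#) ⟩
      (0# - 1# * 1#) + 1# * 1#
        ≈⟨ //-rightDividesˡ _ _ ⟩
      0# ∎

    PochXStep : ℕ → ℕ → ℕ → Set ℓ
    PochXStep n s i = poch R q (suc (suc n)) (suc i) * pow R (X s) (suc n)
      ≈ poch R q (suc n) (suc i) * pow R (X s) n * X (suc (s ℕ.+ i)) + poch R q (suc n) i * pow R (X s) n * Y n (s ℕ.+ i)

    pochXStep-vanish : ∀ {n} s {i} → suc n < i → PochXStep n s i
    pochXStep-vanish {n} s {i} 1+n<i = begin
      poch R q (suc (suc n)) (suc i) * pow R (X s) (suc n)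
        ≈⟨ trans (*-cong (poch-vanish q (s≤s 1+n<i)) refl) (zeroˡ _) ⟩
      0#
        ≈⟨ solve 3 (λ a b c → con 0 := con 0 :* a :* b :+ con 0 :* a :* c) refl (pow R (X s) n) (X (suc (s ℕ.+ i))) (Y n (s ℕ.+ i)) ⟩
      0# * pow R (X s) n * X (suc (s ℕ.+ i)) + 0# * pow R (X s) n * Y n (s ℕ.+ i)
        ≈⟨ +-cong (*-cong (*-cong (poch-vanish q (ℕₚ.m<n⇒m<1+n 1+n<i)) refl) refl)
                  (*-cong (*-cong (poch-vanish q 1+n<i) refl) refl) ⟨
      poch R q (suc n) (suc i) * pow R (X s) n * X (suc (s ℕ.+ i)) + poch R q (suc n) i * pow R (X s) n * Y n (s ℕ.+ i) ∎

    -- Both sides plus z equal M: the left by the recurrence of (t;q)_(n+2), the right by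
    -- expanding X and Y around X_(s+i) and applying the coefficient ratio of (t;q)_(n+1).
    pochXStep-≤ : ∀ {n} s {i} → i ≤ suc n → PochXStep n s i
    pochXStep-≤ {n} s {i} i≤1+n = ∙-cancelʳ z _ _ (trans lhs+z (sym rhs+z))
      where
      Xⁿ = pow R (X s) n
      Qᴺ = pow R q (suc n)
      P = poch R q (suc n)
      z = Qᴺ * P i * (X s * Xⁿ) + X (s ℕ.+ i) * P i * Xⁿ
      M = P (suc i) * X s * Xⁿ + X (s ℕ.+ i) * P i * Xⁿ
      lhs+z : poch R q (suc (suc n)) (suc i) * (X s * Xⁿ) + z ≈ M
      lhs+z = begin
        poch R q (suc (suc n)) (suc i) * (X s * Xⁿ) + z
          ≈⟨ solve 6 (λ D Xˢ Xⁿ Qᴺ Pⁱ Xˢⁱ → D :* (Xˢ :* Xⁿ) :+ (Qᴺ :* Pⁱ :* (Xˢ :* Xⁿ) :+ Xˢⁱ :* Pⁱ :* Xⁿ)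
                          := (D :+ Qᴺ :* Pⁱ) :* Xˢ :* Xⁿ :+ Xˢⁱ :* Pⁱ :* Xⁿ)
               refl (poch R q (suc (suc n)) (suc i)) (X s) Xⁿ Qᴺ (P i) (X (s ℕ.+ i)) ⟩
        (poch R q (suc (suc n)) (suc i) + Qᴺ * P i) * X s * Xⁿ + X (s ℕ.+ i) * P i * Xⁿ
          ≈⟨ +-cong (*-cong (*-cong (poch-suc-suc q (suc n) i) refl) refl) refl ⟩
        M ∎
      rhs+z : P (suc i) * Xⁿ * X (suc (s ℕ.+ i)) + P i * Xⁿ * Y n (s ℕ.+ i) + z ≈ M
      rhs+z = begin
        P (suc i) * Xⁿ * X (suc (s ℕ.+ i)) + P i * Xⁿ * Y n (s ℕ.+ i) + z
          ≈⟨ solve 8 (λ P⁺ Xⁿ X⁺ Pⁱ Yˢⁱ Qᴺ Xˢ Xˢⁱ → P⁺ :* Xⁿ :* X⁺ :+ Pⁱ :* Xⁿ :* Yˢⁱ :+ (Qᴺ :* Pⁱ :* (Xˢ :* Xⁿ) :+ Xˢⁱ :* Pⁱ :* Xⁿ)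
                          := P⁺ :* Xⁿ :* X⁺ :+ Pⁱ :* Xⁿ :* ((Yˢⁱ :+ Xˢⁱ) :+ Qᴺ :* Xˢ))
               refl (P (suc i)) Xⁿ (X (suc (s ℕ.+ i))) (P i) (Y n (s ℕ.+ i)) Qᴺ (X s) (X (s ℕ.+ i)) ⟩
        P (suc i) * Xⁿ * X (suc (s ℕ.+ i)) + P i * Xⁿ * ((Y n (s ℕ.+ i) + X (s ℕ.+ i)) + Qᴺ * X s)
          ≈⟨ +-cong (*-cong refl (trans (reflexive (≡.cong X (≡.sym (ℕₚ.+-suc s i)))) (X-shift s (suc i))))
                    (*-cong refl (trans (+-cong (Y+X n (s ℕ.+ i)) refl) (X-split s i i≤1+n))) ⟩
        P (suc i) * Xⁿ * (X s + pow R q s * qint R q (suc i) * (q + α))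
          + P i * Xⁿ * (X (s ℕ.+ i) + pow R q (s ℕ.+ i) * qint R q (suc n ∸ i) * (q + α))
          ≈⟨ +-cong refl (*-cong refl (+-cong refl (*-cong (*-cong (pow-+ q s i) refl) refl))) ⟩
        P (suc i) * Xⁿ * (X s + pow R q s * qint R q (suc i) * (q + α))
          + P i * Xⁿ * (X (s ℕ.+ i) + pow R q s * pow R q i * qint R q (suc n ∸ i) * (q + α))
          ≈⟨ solve 10 (λ P⁺ Xⁿ Xˢ Qˢ Q⁺ b Pⁱ Xˢⁱ Qⁱ E →
                 P⁺ :* Xⁿ :* (Xˢ :+ Qˢ :* Q⁺ :* b) :+ Pⁱ :* Xⁿ :* (Xˢⁱ :+ Qˢ :* Qⁱ :* E :* b)
                 := (P⁺ :* Xˢ :* Xⁿ :+ Xˢⁱ :* Pⁱ :* Xⁿ) :+ Xⁿ :* Qˢ :* b :* (Q⁺ :* P⁺ :+ Qⁱ :* E :* Pⁱ))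
               refl (P (suc i)) Xⁿ (X s) (pow R q s) (qint R q (suc i)) (q + α) (P i) (X (s ℕ.+ i)) (pow R q i) (qint R q (suc n ∸ i)) ⟩
        M + Xⁿ * pow R q s * (q + α) * (qint R q (suc i) * P (suc i) + pow R q i * qint R q (suc n ∸ i) * P i)
          ≈⟨ +-cong refl (trans (*-cong refl (poch-ratio q (suc n) i)) (zeroʳ _)) ⟩
        M + 0#
          ≈⟨ +-identityʳ M ⟩
        M ∎

    pochXStep : ∀ n s i → PochXStep n s i
    pochXStep n s i with i ℕₚ.≤? suc n
    ... | yes i≤1+n = pochXStep-≤ s i≤1+n
    ... | no i≰1+n = pochXStep-vanish s (ℕₚ.≰⇒> i≰1+n)

    seriesCoeff-insertStep : ∀ n k → seriesCoeff (suc n) k ≈ insertStep n (seriesCoeff n) k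
    seriesCoeff-insertStep n zero =
      solve 3 (λ P Xᶻ Xⁿ → P :* (Xᶻ :* Xⁿ) :+ con 0 := (P :* Xⁿ :+ con 0) :* Xᶻ) refl (poch R q (suc n) 0) (X 0) (pow R (X 0) n)
    seriesCoeff-insertStep n (suc k) = begin
      seriesCoeff (suc n) (suc k)
        ≈⟨ ∑-upTo-head (suc k) _ ⟩
      P 0 * (X (suc k) * Xⁿ (suc k)) + (∑[ i ∈ upTo (suc k) ] poch R q (suc (suc n)) (suc i) * pow R (X (k ∸ i)) (suc n))
        ≈⟨ +-cong refl (∑-cong-All (Allₚ.all-upTo (suc k)) split-term) ⟩
      P 0 * (X (suc k) * Xⁿ (suc k)) + (∑[ i ∈ upTo (suc k) ] (P (suc i) * Xⁿ (k ∸ i) * X (suc k) + P i * Xⁿ (k ∸ i) * Y n k))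
        ≈⟨ +-cong refl (trans (∑-+ (upTo (suc k)) _ _) (+-cong (∑-*ʳ (upTo (suc k)) _ _) (∑-*ʳ (upTo (suc k)) _ _))) ⟩
      P 0 * (X (suc k) * Xⁿ (suc k)) + ((∑[ i ∈ upTo (suc k) ] P (suc i) * Xⁿ (k ∸ i)) * X (suc k) + seriesCoeff n k * Y n k)
        ≈⟨ solve 5 (λ P₀ X⁺ Xⁿ S C → P₀ :* (X⁺ :* Xⁿ) :+ (S :* X⁺ :+ C) := (P₀ :* Xⁿ :+ S) :* X⁺ :+ C)
             refl (P 0) (X (suc k)) (Xⁿ (suc k)) _ _ ⟩
      (P 0 * Xⁿ (suc k) + (∑[ i ∈ upTo (suc k) ] P (suc i) * Xⁿ (k ∸ i))) * X (suc k) + seriesCoeff n k * Y n k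
        ≈⟨ +-cong (*-cong (sym (∑-upTo-head (suc k) _)) refl) refl ⟩
      seriesCoeff n (suc k) * X (suc k) + seriesCoeff n k * Y n k ∎
      where
      P = poch R q (suc n)
      Xⁿ : ℕ → Carrier
      Xⁿ j = pow R (X j) n
      split-term : ∀ {i} → i < suc k → poch R q (suc (suc n)) (suc i) * pow R (X (k ∸ i)) (suc n)
                                       ≈ P (suc i) * Xⁿ (k ∸ i) * X (suc k) + P i * Xⁿ (k ∸ i) * Y n k
      split-term {i} i<1+k = ≡.subst (λ j → poch R q (suc (suc n)) (suc i) * pow R (X (k ∸ i)) (suc n)
                                              ≈ P (suc i) * Xⁿ (k ∸ i) * X (suc j) + P i * Xⁿ (k ∸ i) * Y n j)
                               (ℕₚ.m∸n+n≡m (ℕₚ.≤-pred i<1+k)) (pochXStep n (k ∸ i) i)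

  module _ (r′ : ℕ) (q a : Carrier) where

    α : Carrier
    α = a * qint R a r′

    coeff : ℕ → CPerm → Carrier
    coeff k γ = ⟦ desG γ ≡ᵇ k ⟧* (pow R q (maj γ) * pow R a (col γ))

    ∑-pow-suc : (∑[ c ∈ upTo r′ ] pow R a (suc c)) ≈ α
    ∑-pow-suc = trans (∑-*ˡ (upTo r′) a (pow R a)) (*-cong refl (trans (∑-pow-upTo a 0 r′) (*-identityˡ _)))

    -- Color 0 makes the new letter n+1 the largest one, every other color the smallest one.
    ∑-colored-inserts : ∀ (g : ℕ → ℕ → Carrier) γ → LettersBelow (length γ) γ →
      (∑[ c ∈ upTo (suc r′) ] ∑[ w ∈ inserts (suc (length γ) , c) γ ] weight g (0 , 0) w * pow R a (col w))
        ≈ topInsertionSum g (desG γ) (maj γ) (length γ) * pow R a (col γ)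
          + bottomInsertionSum g (desG γ) (maj γ) (length γ) * (α * pow R a (col γ))
    ∑-colored-inserts g γ below = begin
      (∑[ c ∈ upTo (suc r′) ] ∑[ w ∈ inserts (L c) γ ] weight g (0 , 0) w * pow R a (col w))
        ≈⟨ ∑-cong (upTo (suc r′)) (λ c → trans (∑-cong-All (col-inserts (L c) γ) (λ col≡ → *-cong refl
             (trans (reflexive (≡.cong (pow R a) col≡)) (pow-+ a c (col γ))))) (∑-*ʳ (inserts (L c) γ) _ _)) ⟩
      (∑[ c ∈ upTo (suc r′) ] ∑ (inserts (L c) γ) (weight g (0 , 0)) * (pow R a c * A))
        ≈⟨ ∑-upTo-head r′ _ ⟩
      ∑ (inserts (L 0) γ) (weight g (0 , 0)) * (1# * A)
        + (∑[ c ∈ upTo r′ ] ∑ (inserts (L (suc c)) γ) (weight g (0 , 0)) * (pow R a (suc c) * A))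
        ≈⟨ +-cong (*-cong (∑-inserts-top g (0 , 0) γ ≡.refl below-top top-above) (*-identityˡ A))
                  (∑-cong (upTo r′) (λ c → *-cong (∑-inserts-bottom g (0 , 0) γ ≡.refl above-bottom bottom-below) refl)) ⟩
      Top * A + (∑[ c ∈ upTo r′ ] Bot * (pow R a (suc c) * A))
        ≈⟨ +-cong refl (trans (∑-*ˡ (upTo r′) Bot _) (*-cong refl (trans (∑-*ʳ (upTo r′) A _) (*-cong ∑-pow-suc refl)))) ⟩
      Top * A + Bot * (α * A) ∎
      where
      L : ℕ → ColInt
      L c = (suc (length γ) , c)
      A = pow R a (col γ)
      Top = topInsertionSum g (desG γ) (maj γ) (length γ)
      Bot = bottomInsertionSum g (desG γ) (maj γ) (length γ)
      below-top = All.map (λ {y} → <c-top {y = y}) below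
      top-above = All.map (λ {y} → top-≮c {y = y}) below
      above-bottom : ∀ {d} → All (λ y → y <c (suc (length γ) , suc d) ≡ false) γ
      above-bottom = All.map (λ {y} → ≮c-bottom {y = y}) below
      bottom-below : ∀ {d} → All (λ y → (suc (length γ) , suc d) <c y ≡ true) γ
      bottom-below = All.map (λ {y} → bottom-<c {y = y}) below

    ∑-inserts-coeff : ∀ {n} γ → length γ ≡ n → LettersBelow n γ → ∀ k →
      (∑[ c ∈ upTo (suc r′) ] ∑ (inserts (suc n , c) γ) (coeff k)) ≈ insertStep q α n (λ j → coeff j γ) k
    ∑-inserts-coeff {n} γ ≡.refl below k = begin
      (∑[ c ∈ upTo (suc r′) ] ∑ (inserts (suc n , c) γ) (coeff k))
        ≈⟨ ∑-cong (upTo (suc r′)) (λ c → ∑-cong (inserts (suc n , c) γ) (λ w → sym (⟦⟧*-*ʳ (desG w ≡ᵇ k) _ _))) ⟩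
      (∑[ c ∈ upTo (suc r′) ] ∑[ w ∈ inserts (suc n , c) γ ] weight (tCoeff q k) (0 , 0) w * pow R a (col w))
        ≈⟨ ∑-colored-inserts (tCoeff q k) γ below ⟩
      topInsertionSum (tCoeff q k) (desG γ) (maj γ) n * A + bottomInsertionSum (tCoeff q k) (desG γ) (maj γ) n * (α * A)
        ≈⟨ insertionSums-monomial q α k (maj γ) A (length-desList≤ 0 (0 , 0) γ) ⟩
      insertStep q α n (λ j → coeff j γ) k ∎
      where
      A = pow R a (col γ)

    numer-zero : ∀ k → numer R (suc r′) 0 q a k ≈ ⟦ 0 ≡ᵇ k ⟧* 1#
    numer-zero k = trans (+-identityʳ _) (⟦⟧*-cong (0 ≡ᵇ k) (*-identityʳ 1#))

    numer-insertStep : ∀ n k → numer R (suc r′) (suc n) q a k ≈ insertStep q α n (numer R (suc r′) n q a) k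
    numer-insertStep n k = begin
      ∑ (G (suc r′) (suc n)) (coeff k)
        ≈⟨ ∑-G-suc (suc r′) n (coeff k) ⟩
      (∑[ γ ∈ G (suc r′) n ] ∑[ c ∈ upTo (suc r′) ] ∑ (inserts (suc n , c) γ) (coeff k))
        ≈⟨ ∑-cong-All (G-wellFormed (suc r′) n) (λ {γ} (len≡ , below) → ∑-inserts-coeff γ len≡ below k) ⟩
      (∑[ γ ∈ G (suc r′) n ] insertStep q α n (λ j → coeff j γ) k)
        ≈⟨ ∑-insertStep q α n (G (suc r′) n) (λ γ j → coeff j γ) k ⟩
      insertStep q α n (numer R (suc r′) n q a) k ∎

    numer≈seriesCoeff : ∀ n k → numer R (suc r′) n q a k ≈ seriesCoeff q α n k
    numer≈seriesCoeff zero k = trans (numer-zero k) (sym (seriesCoeff-zero q α k))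
    numer≈seriesCoeff (suc n) k = begin
      numer R (suc r′) (suc n) q a k                 ≈⟨ numer-insertStep n k ⟩
      insertStep q α n (numer R (suc r′) n q a) k    ≈⟨ insertStep-cong q α n (numer≈seriesCoeff n) k ⟩
      insertStep q α n (seriesCoeff q α n) k         ≈⟨ seriesCoeff-insertStep q α n k ⟨
      seriesCoeff q α (suc n) k                      ∎

mainTheorem12 : {c ℓ : Level} (R : CommutativeRing c ℓ) (r n : ℕ) → 1 ≤ r → 1 ≤ n →
                  (q a : CommutativeRing.Carrier R) (k : ℕ) →
                  CommutativeRing._≈_ R (numer R r n q a k)
                    (conv R (poch R q (suc n)) (rhs R r n q a) k)
mainTheorem12 R (suc r′) n (s≤s z≤n) _ q a k = numer≈seriesCoeff R r′ q a n k
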